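{- Let $q$ be a prime power and $k$ an odd integer, and let $\mathcal F$ be a radical $(q,k,1)$ difference family in the additive group of $\mathbb F_q$. Then $\mathcal F$ is a Banff difference family.
   Context: A $(v,k,\lambda)$ difference family in an additive group $G$ of order $v$ is a set $\mathcal F$ of $k$-subsets of $G$ (base blocks) such that the list $\{x-y: x,y\in B, x\neq y, B\in\mathcal F\}$ contains every nonzero element of $G$ exactly $\lambda$ times. A $(q,k,1)$ difference family in $\mathbb F_q$ with $k$ odd is called radical if each of its base blocks is a coset (in $\mathbb F_q^*$) of the multiplicative group of $k$-th roots of unity of $\mathbb F_q$. A Banff difference family is a difference family $\{B_1,\dots,B_n\}$ whose base blocks are pairwise disjoint, such that $0\notin B_i$ for all $i$ and $B_i\cap -B_j=\emptyset$ for every pair $(i,j)$ (including $i=j$), where $-B=\{ -b:b\in B\}$. -}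

module Defs where

open import Level using (Level; _⊔_) renaming (suc to lsuc)
open import Data.Nat using (ℕ; zero; suc; _≥_)
open import Data.Nat.Primality using (Prime)
open import Data.Fin using (Fin)
open import Data.Product using (Σ; ∃; ∃-syntax; _×_; _,_)
open import Relation.Binary.PropositionalEquality using (_≡_)
open import Relation.Nullary using (¬_)
open import Algebra.Structures using (IsCommutativeRing)
open import Function.Bundles using (_↔_)
import Data.Nat as ℕ

IsPrimePower : ℕ → Set
IsPrimePower q = ∃[ p ] ∃[ e ] (Prime p × e ≥ 1 × q ≡ p ℕ.^ e)

Odd : ℕ → Set
Odd k = ∃[ m ] k ≡ suc (2 ℕ.* m)

record FiniteField (q : ℕ) : Set₁ where
  infixl 7 _*_
  infixl 6 _+_
  field
    Carrier : Set
    _+_ _*_ : Carrier → Carrier → Carrier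
    -_      : Carrier → Carrier
    0# 1#   : Carrier
    isCommutativeRing : IsCommutativeRing _≡_ _+_ _*_ -_ 0# 1#
    0≢1     : ¬ (0# ≡ 1#)
    inverse : ∀ x → ¬ (x ≡ 0#) → ∃[ y ] (x * y ≡ 1#)
    enumeration : Fin q ↔ Carrier

  _-_ : Carrier → Carrier → Carrier
  x - y = x + (- y)

  _^_ : Carrier → ℕ → Carrier
  x ^ zero  = 1#
  x ^ suc n = x * (x ^ n)

module _ {q : ℕ} (F : FiniteField q) where
  open FiniteField F

  Block : ℕ → Set
  Block k = Fin k → Carrier

  IsKSubset : (k : ℕ) → Block k → Set
  IsKSubset k B = ∀ a b → B a ≡ B b → a ≡ b

  _∈B_ : {k : ℕ} → Carrier → Block k → Set
  x ∈B B = ∃[ a ] (B a ≡ x)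

  IsDifferenceFamily1 : (k n : ℕ) → (Fin n → Block k) → Set
  IsDifferenceFamily1 k n 𝓕 =
    (∀ i → IsKSubset k (𝓕 i)) ×
    (∀ g → ¬ (g ≡ 0#) →
      (∃[ i ] ∃[ a ] ∃[ b ] (¬ (a ≡ b) × 𝓕 i a - 𝓕 i b ≡ g)) ×
      (∀ i a b i′ a′ b′ → ¬ (a ≡ b) → ¬ (a′ ≡ b′) →
         𝓕 i a - 𝓕 i b ≡ g → 𝓕 i′ a′ - 𝓕 i′ b′ ≡ g →
         i ≡ i′ × a ≡ a′ × b ≡ b′))

  RootOfUnity : ℕ → Carrier → Set
  RootOfUnity k u = u ^ k ≡ 1#

  IsRadical : (k n : ℕ) → (Fin n → Block k) → Set
  IsRadical k n 𝓕 = ∀ i → ∃[ c ] (¬ (c ≡ 0#) ×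
    (∀ x → (x ∈B 𝓕 i → ∃[ u ] (RootOfUnity k u × x ≡ c * u))
         × (∃[ u ] (RootOfUnity k u × x ≡ c * u) → x ∈B 𝓕 i)))

  IsBanff : (k n : ℕ) → (Fin n → Block k) → Set
  IsBanff k n 𝓕 =
    (∀ i j → ¬ (i ≡ j) → ∀ a c → ¬ (𝓕 i a ≡ 𝓕 j c)) ×
    (∀ i a → ¬ (𝓕 i a ≡ 0#)) ×
    (∀ i j a c → ¬ (𝓕 i a ≡ - 𝓕 j c))

{-# OPTIONS --safe #-}
-- Every block of a radical family is a coset cU of the group U of k-th roots
-- of unity, so a block meeting a multiple μB of another block contains all of
-- μB.  Taking μ = 1, two distinct blocks that meet would repeat the
-- differences of one of them.  Taking μ = -1, a block B′ ⊇ -B would contain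
-- each difference x - y of B again as (-y) - (-x), which λ = 1 forbids once
-- k ≥ 3; and an odd k is either 1, where no difference family exists, or at
-- least 3.  Finally 0 ∉ cU since c ≠ 0 and roots of unity are nonzero.
module Submission where

open import Defs
open import Algebra.Bundles using (Ring)
open import Algebra.Structures using (IsCommutativeRing)
import Algebra.Properties.Ring as RingProperties
open import Data.Empty using (⊥-elim)
open import Data.Fin using (Fin; zero; suc)
open import Data.Fin.Properties using (0≢1+n; suc-injective)
open import Data.Nat using (ℕ; zero; suc)
import Data.Nat as ℕ
open import Data.Nat.Properties using (+-suc)
open import Data.Product using (∃-syntax; _×_; _,_; proj₁; proj₂)
open import Data.Sum using (_⊎_; inj₁; inj₂)
open import Relation.Nullary using (¬_)
open import Relation.Binary.PropositionalEquality
  using (_≡_; _≢_; refl; sym; trans; cong; cong₂; subst; module ≡-Reasoning)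

Odd⇒≡1⊎≡3+ : ∀ k → Odd k → k ≡ 1 ⊎ ∃[ j ] k ≡ suc (suc (suc j))
Odd⇒≡1⊎≡3+ k (zero , k≡1) = inj₁ k≡1
Odd⇒≡1⊎≡3+ k (suc m , refl) = inj₂ (2 ℕ.* m , cong (λ n → suc (suc n)) (+-suc m (m ℕ.+ 0)))

module _ {q : ℕ} (F : FiniteField q) where
  open FiniteField F
  open IsCommutativeRing isCommutativeRing
    using (*-assoc; *-comm; +-comm; *-identityˡ; zeroˡ; zeroʳ)
  open ≡-Reasoning

  infix 4 _∈_
  _∈_ : ∀ {k} → Carrier → Block F k → Set
  x ∈ B = _∈B_ F x B

  ring : Ring _ _
  ring = record { isRing = IsCommutativeRing.isRing isCommutativeRing }

  open RingProperties ring using (x∙y⁻¹≈ε⇒x≈y; -‿involutive; -‿injective; -1*x≈-x)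

  x*y≡0⇒y≡0 : ∀ {x y} → x ≢ 0# → x * y ≡ 0# → y ≡ 0#
  x*y≡0⇒y≡0 {x} {y} x≢0 xy≡0 with inverse x x≢0
  ... | x⁻¹ , xx⁻¹≡1 = begin
    y               ≡⟨ sym (*-identityˡ y) ⟩
    1# * y          ≡⟨ cong (_* y) (trans (sym xx⁻¹≡1) (*-comm x x⁻¹)) ⟩
    (x⁻¹ * x) * y   ≡⟨ *-assoc x⁻¹ x y ⟩
    x⁻¹ * (x * y)   ≡⟨ cong (x⁻¹ *_) xy≡0 ⟩
    x⁻¹ * 0#        ≡⟨ zeroʳ x⁻¹ ⟩
    0#              ∎

  -y-[-x]≡x-y : ∀ x y → (- y) - (- x) ≡ x - y
  -y-[-x]≡x-y x y = trans (cong (- y +_) (-‿involutive x)) (+-comm (- y) x)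

  ^-distrib-* : ∀ x y n → (x * y) ^ n ≡ x ^ n * y ^ n
  ^-distrib-* x y zero    = sym (*-identityˡ 1#)
  ^-distrib-* x y (suc n) = begin
    (x * y) * (x * y) ^ n        ≡⟨ cong ((x * y) *_) (^-distrib-* x y n) ⟩
    (x * y) * (x ^ n * y ^ n)    ≡⟨ *-assoc x y _ ⟩
    x * (y * (x ^ n * y ^ n))    ≡⟨ cong (x *_) (sym (*-assoc y (x ^ n) (y ^ n))) ⟩
    x * ((y * x ^ n) * y ^ n)    ≡⟨ cong (λ z → x * (z * y ^ n)) (*-comm y (x ^ n)) ⟩
    x * ((x ^ n * y) * y ^ n)    ≡⟨ cong (x *_) (*-assoc (x ^ n) y (y ^ n)) ⟩
    x * (x ^ n * (y * y ^ n))    ≡⟨ sym (*-assoc x (x ^ n) _) ⟩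
    (x * x ^ n) * (y * y ^ n)    ∎

  1^n≡1 : ∀ n → 1# ^ n ≡ 1#
  1^n≡1 zero    = refl
  1^n≡1 (suc n) = trans (*-identityˡ _) (1^n≡1 n)

  RootOfUnity-* : ∀ {k u v} → RootOfUnity F k u → RootOfUnity F k v →
                  RootOfUnity F k (u * v)
  RootOfUnity-* {k} {u} {v} uᵏ≡1 vᵏ≡1 = begin
    (u * v) ^ k     ≡⟨ ^-distrib-* u v k ⟩
    u ^ k * v ^ k   ≡⟨ cong₂ _*_ uᵏ≡1 vᵏ≡1 ⟩
    1# * 1#         ≡⟨ *-identityˡ 1# ⟩
    1#              ∎

  RootOfUnity-inverse : ∀ {k u} → RootOfUnity F (suc k) u → RootOfUnity F (suc k) (u ^ k)
  RootOfUnity-inverse {k} {u} uᵏ⁺¹≡1 = begin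
    (u ^ k) ^ suc k                ≡⟨ sym (*-identityˡ _) ⟩
    1# * (u ^ k) ^ suc k           ≡⟨ cong (_* (u ^ k) ^ suc k) (sym uᵏ⁺¹≡1) ⟩
    u ^ suc k * (u ^ k) ^ suc k    ≡⟨ sym (^-distrib-* u (u ^ k) (suc k)) ⟩
    (u * u ^ k) ^ suc k            ≡⟨ cong (_^ suc k) uᵏ⁺¹≡1 ⟩
    1# ^ suc k                     ≡⟨ 1^n≡1 (suc k) ⟩
    1#                             ∎

  RootOfUnity-≢0 : ∀ {k u} → RootOfUnity F (suc k) u → u ≢ 0#
  RootOfUnity-≢0 {k} {u} uᵏ⁺¹≡1 refl = 0≢1 (trans (sym (zeroˡ (u ^ k))) uᵏ⁺¹≡1)

  InCoset : ℕ → Carrier → Carrier → Set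
  InCoset k c x = ∃[ u ] (RootOfUnity F k u × x ≡ c * u)

  InCoset-*root : ∀ {k c x v} → InCoset k c x → RootOfUnity F k v → InCoset k c (x * v)
  InCoset-*root {k} {v = v} (u , uᵏ≡1 , refl) vᵏ≡1 =
    u * v , RootOfUnity-* {k} uᵏ≡1 vᵏ≡1 , *-assoc _ u v

  coset-ratio : ∀ {k c x y} → InCoset (suc k) c x → InCoset (suc k) c y →
                ∃[ w ] (RootOfUnity F (suc k) w × y ≡ x * w)
  coset-ratio {k} {c} (u , uᵏ⁺¹≡1 , refl) (v , vᵏ⁺¹≡1 , refl) =
    u ^ k * v , RootOfUnity-* {suc k} (RootOfUnity-inverse {k} uᵏ⁺¹≡1) vᵏ⁺¹≡1 , (begin
      c * v                    ≡⟨ cong (c *_) (sym (*-identityˡ v)) ⟩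
      c * (1# * v)             ≡⟨ cong (λ z → c * (z * v)) (sym uᵏ⁺¹≡1) ⟩
      c * ((u * u ^ k) * v)    ≡⟨ cong (c *_) (*-assoc u (u ^ k) v) ⟩
      c * (u * (u ^ k * v))    ≡⟨ sym (*-assoc c u _) ⟩
      (c * u) * (u ^ k * v)    ∎)

  module Radical {k n : ℕ} {𝓕 : Fin n → Block F (suc k)}
                 (rad : IsRadical F (suc k) n 𝓕) where

    block-≢0 : ∀ i a → 𝓕 i a ≢ 0#
    block-≢0 i a 𝓕ᵢa≡0 with rad i
    ... | c , c≢0 , coset with proj₁ (coset (𝓕 i a)) (a , refl)
    ... | u , uᵏ⁺¹≡1 , 𝓕ᵢa≡cu =
      RootOfUnity-≢0 {k} uᵏ⁺¹≡1 (x*y≡0⇒y≡0 c≢0 (trans (sym 𝓕ᵢa≡cu) 𝓕ᵢa≡0))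

    scaled-block-⊆ : ∀ μ i j a → (μ * 𝓕 i a) ∈ 𝓕 j → ∀ b → (μ * 𝓕 i b) ∈ 𝓕 j
    scaled-block-⊆ μ i j a μ𝓕ᵢa∈𝓕ⱼ b with rad i | rad j
    ... | _ , _ , coset-i | c′ , _ , coset-j
      with coset-ratio {k} (proj₁ (coset-i (𝓕 i a)) (a , refl))
                           (proj₁ (coset-i (𝓕 i b)) (b , refl))
    ... | w , wᵏ⁺¹≡1 , 𝓕ᵢb≡𝓕ᵢa*w =
      proj₂ (coset-j _) (subst (InCoset (suc k) c′) μ𝓕ᵢa*w≡μ𝓕ᵢb
        (InCoset-*root {suc k} (proj₁ (coset-j _) μ𝓕ᵢa∈𝓕ⱼ) wᵏ⁺¹≡1))
      where
      μ𝓕ᵢa*w≡μ𝓕ᵢb : (μ * 𝓕 i a) * w ≡ μ * 𝓕 i b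
      μ𝓕ᵢa*w≡μ𝓕ᵢb = trans (*-assoc μ _ w) (cong (μ *_) (sym 𝓕ᵢb≡𝓕ᵢa*w))

  no-difference-family-of-singletons : ∀ {n} {𝓕 : Fin n → Block F 1} →
                                       ¬ IsDifferenceFamily1 F 1 n 𝓕
  no-difference-family-of-singletons (_ , covered)
    with proj₁ (covered 1# (λ 1≡0 → 0≢1 (sym 1≡0)))
  ... | _ , zero , zero , 0≢0 , _ = 0≢0 refl

  module DifferenceFamily {k n : ℕ} {𝓕 : Fin n → Block F k}
                          (df : IsDifferenceFamily1 F k n 𝓕) where

    difference-≢0 : ∀ i {a b} → a ≢ b → 𝓕 i a - 𝓕 i b ≢ 0#
    difference-≢0 i a≢b d≡0 = a≢b (proj₁ df i _ _ (x∙y⁻¹≈ε⇒x≈y _ _ d≡0))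

    difference-unique : ∀ {i a b i′ a′ b′} → a ≢ b → a′ ≢ b′ →
                        𝓕 i a - 𝓕 i b ≡ 𝓕 i′ a′ - 𝓕 i′ b′ →
                        i ≡ i′ × a ≡ a′ × b ≡ b′
    difference-unique {i} {a} {b} {i′} {a′} {b′} a≢b a′≢b′ d≡d′ =
      proj₂ (proj₂ df _ (difference-≢0 i a≢b)) i a b i′ a′ b′ a≢b a′≢b′ refl (sym d≡d′)

  module _ {k n : ℕ} {𝓕 : Fin n → Block F (suc (suc k))}
           (df : IsDifferenceFamily1 F (suc (suc k)) n 𝓕) where
    open DifferenceFamily df

    block-⊆⇒≡ : ∀ {i j} → (∀ b → 𝓕 i b ∈ 𝓕 j) → i ≡ j
    block-⊆⇒≡ {i} {j} 𝓕ᵢ⊆𝓕ⱼ with 𝓕ᵢ⊆𝓕ⱼ zero | 𝓕ᵢ⊆𝓕ⱼ (suc zero)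
    ... | p₀ , 𝓕ⱼp₀≡𝓕ᵢ0 | p₁ , 𝓕ⱼp₁≡𝓕ᵢ1 =
      proj₁ (difference-unique (λ ()) p₀≢p₁ (sym (cong₂ _-_ 𝓕ⱼp₀≡𝓕ᵢ0 𝓕ⱼp₁≡𝓕ᵢ1)))
      where
      p₀≢p₁ : p₀ ≢ p₁
      p₀≢p₁ refl = 0≢1+n (proj₁ df i zero (suc zero) (trans (sym 𝓕ⱼp₀≡𝓕ᵢ0) 𝓕ⱼp₁≡𝓕ᵢ1))

  module _ {k n : ℕ} {𝓕 : Fin n → Block F (suc (suc (suc k)))}
           (df : IsDifferenceFamily1 F (suc (suc (suc k))) n 𝓕) where
    open DifferenceFamily df

    -- With 𝓕 j (w t) = - 𝓕 i t, the difference 𝓕 i t - 𝓕 i s reappears as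
    -- 𝓕 j (w s) - 𝓕 j (w t), so uniqueness forces w t ≡ s for every s ≢ t.
    ¬negated-block-⊆ : ∀ {i j} → ¬ (∀ b → (- 𝓕 i b) ∈ 𝓕 j)
    ¬negated-block-⊆ {i} {j} -𝓕ᵢ⊆𝓕ⱼ =
      0≢1+n (suc-injective (trans (pairing {zero} {suc zero} (λ ()))
                                  (sym (pairing {zero} {suc (suc zero)} (λ ())))))
      where
      w : Fin (suc (suc (suc k))) → Fin (suc (suc (suc k)))
      w t = proj₁ (-𝓕ᵢ⊆𝓕ⱼ t)

      𝓕ⱼw≡- : ∀ b → 𝓕 j (w b) ≡ - 𝓕 i b
      𝓕ⱼw≡- b = proj₂ (-𝓕ᵢ⊆𝓕ⱼ b)

      pairing : ∀ {t s} → t ≢ s → s ≡ w t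
      pairing {t} {s} t≢s = proj₂ (proj₂ (difference-unique t≢s wₛ≢wₜ 𝓕ᵢt-𝓕ᵢs≡))
        where
        wₛ≢wₜ : w s ≢ w t
        wₛ≢wₜ wₛ≡wₜ = t≢s (proj₁ df i t s (-‿injective
          (trans (sym (𝓕ⱼw≡- t)) (trans (cong (𝓕 j) (sym wₛ≡wₜ)) (𝓕ⱼw≡- s)))))

        𝓕ᵢt-𝓕ᵢs≡ : 𝓕 i t - 𝓕 i s ≡ 𝓕 j (w s) - 𝓕 j (w t)
        𝓕ᵢt-𝓕ᵢs≡ = sym (trans (cong₂ _-_ (𝓕ⱼw≡- s) (𝓕ⱼw≡- t)) (-y-[-x]≡x-y (𝓕 i t) (𝓕 i s)))

  radical⇒Banff : ∀ {k n} {𝓕 : Fin n → Block F (suc (suc (suc k)))} →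
                  IsDifferenceFamily1 F (suc (suc (suc k))) n 𝓕 →
                  IsRadical F (suc (suc (suc k))) n 𝓕 →
                  IsBanff F (suc (suc (suc k))) n 𝓕
  radical⇒Banff {𝓕 = 𝓕} df rad = disjoint , block-≢0 , disjoint-from-negatives
    where
    open Radical rad

    disjoint : ∀ i j → i ≢ j → ∀ a c → 𝓕 i a ≢ 𝓕 j c
    disjoint i j i≢j a c 𝓕ᵢa≡𝓕ⱼc = i≢j (block-⊆⇒≡ df λ b →
      subst (_∈ 𝓕 j) (*-identityˡ (𝓕 i b))
        (scaled-block-⊆ 1# i j a (c , trans (sym 𝓕ᵢa≡𝓕ⱼc) (sym (*-identityˡ (𝓕 i a)))) b))

    disjoint-from-negatives : ∀ i j a c → 𝓕 i a ≢ - 𝓕 j c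
    disjoint-from-negatives i j a c 𝓕ᵢa≡-𝓕ⱼc = ¬negated-block-⊆ df λ b →
      subst (_∈ 𝓕 j) (-1*x≈-x (𝓕 i b)) (scaled-block-⊆ (- 1#) i j a (c , (begin
        𝓕 j c           ≡⟨ sym (-‿involutive (𝓕 j c)) ⟩
        - (- 𝓕 j c)     ≡⟨ cong -_ (sym 𝓕ᵢa≡-𝓕ⱼc) ⟩
        - 𝓕 i a         ≡⟨ sym (-1*x≈-x (𝓕 i a)) ⟩
        - 1# * 𝓕 i a    ∎)) b)

mainTheorem2 : (q k : ℕ) → IsPrimePower q → Odd k → (F : FiniteField q) →
    (n : ℕ) → (𝓕 : Fin n → Block F k) →
    IsDifferenceFamily1 F k n 𝓕 → IsRadical F k n 𝓕 → IsBanff F k n 𝓕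
mainTheorem2 q k _ k-odd F n 𝓕 df rad with Odd⇒≡1⊎≡3+ k k-odd
... | inj₁ refl       = ⊥-elim (no-difference-family-of-singletons F df)
... | inj₂ (_ , refl) = radical⇒Banff F df rad
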